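{- Let $\Gamma$ be a partial geometry $pg(s,t,\alpha)$ with point set $\mathcal{P}$, $|\mathcal{P}|=v$, identified with $[v]$, and line set $\mathcal{L}$, and suppose $t>s$. Then $\mathcal{L}$ (each line viewed as the $(s+1)$-subset of its points) is a resolving set for the Kneser graph $K(v,s+1)$.
   Context: A partial geometry $pg(s,t,\alpha)$ consists of a finite set of points $\mathcal{P}$ and a set of lines $\mathcal{L}$, each line being a set of points, such that: (i) every line has $s+1$ points and two lines meet in at most one point; (ii) every point lies on $t+1$ lines and two points lie on at most one common line; (iii) if a point $p$ is not on a line $L$, exactly $\alpha$ points of $L$ are collinear with $p$. The Kneser graph $K(n,k)$ has as vertices the $k$-subsets of $[n]$, adjacent when disjoint. A resolving set is a set $\mathcal{S}$ of vertices such that for all distinct vertices $U,W$ some $X\in\mathcal{S}$ has $d(U,X)\neq d(W,X)$, where $d$ is graph distance. -}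

module Defs where

open import Data.Nat using (ℕ; zero; suc; _≤_)
open import Data.Fin using (Fin)
open import Data.Fin.Subset using (Subset; _∈_; _∉_; _∩_; ⋃; ∣_∣; Empty)
open import Data.Fin.Subset.Properties using (_∈?_)
open import Data.List using (List; length; filter)
open import Data.List.Membership.Propositional using () renaming (_∈_ to _∈ˡ_)
open import Data.List.Relation.Unary.Unique.Propositional using (Unique)
open import Data.Product using (Σ; ∃; _×_; _,_)
open import Relation.Nullary using (¬_)
open import Relation.Nullary.Decidable using (_×-dec_)
open import Relation.Binary.PropositionalEquality using (_≡_; _≢_)
open import Function.Bundles using (_⇔_)

record PartialGeometry (v s t α : ℕ) : Set where
  field
    lines      : List (Subset v)
    lines-distinct : Unique lines
    line-size  : ∀ L → L ∈ˡ lines → ∣ L ∣ ≡ suc s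
    lines-meet : ∀ L M → L ∈ˡ lines → M ∈ˡ lines → L ≢ M → ∣ L ∩ M ∣ ≤ 1
    point-degree : ∀ (p : Fin v) → length (filter (p ∈?_) lines) ≡ suc t
    points-join  : ∀ (p q : Fin v) → p ≢ q →
                   length (filter (λ L → (p ∈? L) ×-dec (q ∈? L)) lines) ≤ 1
    -- (iii) if p ∉ L, exactly α points of L are collinear with p
    -- (the points collinear with p are those on some line through p)
    alpha : ∀ (p : Fin v) L → L ∈ˡ lines → p ∉ L →
            ∣ L ∩ ⋃ (filter (p ∈?_) lines) ∣ ≡ α

module Kneser (v k : ℕ) where

  IsVertex : Subset v → Set
  IsVertex U = ∣ U ∣ ≡ k

  Adjacent : Subset v → Subset v → Set
  Adjacent U W = Empty (U ∩ W)

  data Walk : Subset v → Subset v → ℕ → Set where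
    nil  : ∀ {U} → Walk U U 0
    cons : ∀ {U W X n} → IsVertex W → Adjacent U W → Walk W X n → Walk U X (suc n)

  Dist : Subset v → Subset v → ℕ → Set
  Dist U W d = Walk U W d × (∀ m → Walk U W m → d ≤ m)

  IsResolvingSet : List (Subset v) → Set
  IsResolvingSet S =
    (∀ X → X ∈ˡ S → IsVertex X) ×
    (∀ U W → IsVertex U → IsVertex W → U ≢ W →
       ∃ λ X → X ∈ˡ S × ¬ (∀ d → Dist U X d ⇔ Dist W X d))

module Submission where

-- Let U ≠ W be (s+1)-subsets of the points.  Since |U| = |W| there is a point
-- w ∈ W ∖ U.  Every point u ∈ U lies on at most one line through w (two points
-- are joined by at most one line), so by a pigeonhole count at most |U| = s+1
-- of the t+1 lines through w meet U.  As t+1 > s+1, some line L through w is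
-- disjoint from U.  Then L is adjacent to U, so d(U,L) = 1, while L meets W in
-- w, so d(W,L) ≠ 1: the line L distinguishes U from W.

open import Defs
open import Data.Nat using (ℕ; suc; zero; _<_; _≤_; z≤n; s≤s)
open import Data.Nat.Properties using (≤-trans; ≤-<-trans; ≤-reflexive; ≤⇒≯)
open import Data.Fin using (Fin)
import Data.Fin.Properties as Fin
open import Data.Fin.Subset using (Subset; _∈_; _∉_; _∩_; _─_; _⊆_; ∣_∣; Empty; Nonempty; outside)
open import Data.Fin.Subset.Properties
  using (_∈?_; x∈p∩q⁺; x∈p∩q⁻; x∈p∧x∉q⇒x∈p─q; p─q⊆p; p∩q≢∅⇒∣p─q∣<∣p∣;
         p⊂q⇒∣p∣<∣q∣; ⊆-antisym; nonempty?)
open import Data.Vec using (_∷_)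
open import Data.Vec.Base using (here; there)
open import Data.List using (List; []; _∷_; length; filter)
open import Data.List.Membership.Propositional using (find) renaming (_∈_ to _∈ˡ_)
open import Data.List.Membership.Propositional.Properties using (∈-filter⁻)
open import Data.List.Relation.Unary.All using (All; []; _∷_)
import Data.List.Relation.Unary.All as All
import Data.List.Relation.Unary.Any as Any
open import Data.List.Relation.Unary.All.Properties.Core using (¬All⇒Any¬)
open import Data.List.Properties using (filter-accept; filter-reject; filter-some)
open import Data.Product using (∃; _×_; _,_; proj₁; proj₂)
open import Function using (_∘_)
open import Relation.Nullary using (¬_; Dec; yes; no; contradiction)
open import Relation.Nullary.Decidable using (_×-dec_; ¬?)
open import Relation.Unary using (Pred; Decidable)
open import Relation.Binary.PropositionalEquality
  using (_≡_; _≢_; refl; sym; trans; cong; subst; module ≡-Reasoning)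
open import Function.Bundles using (_⇔_; Equivalence)

private
  variable
    n : ℕ

x∈p─q⇒x∉q : ∀ {x : Fin n} (p q : Subset n) → x ∈ p ─ q → x ∉ q
x∈p─q⇒x∉q (_ ∷ p) (outside ∷ q) here        ()
x∈p─q⇒x∉q (_ ∷ p) (_       ∷ q) (there x∈p─q) (there x∈q) = x∈p─q⇒x∉q p q x∈p─q x∈q

Escape : Subset n → Subset n → Set
Escape p q = ∃ λ x → x ∈ p × x ∉ q

escape? : ∀ (p q : Subset n) → Dec (Escape p q)
escape? p q = Fin.any? (λ x → (x ∈? p) ×-dec ¬? (x ∈? q))

⊆-if-no-escape : ∀ (p q : Subset n) → ¬ Escape p q → p ⊆ q
⊆-if-no-escape p q none {x} x∈p with x ∈? q
... | yes x∈q = x∈q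
... | no  x∉q = contradiction (x , x∈p , x∉q) none

-- Two distinct sets with |U| ≤ |W|: W has a point outside U.  Otherwise
-- W ⊆ U; a point of U ∖ W would make W a proper subset, contradicting
-- |U| ≤ |W|, and without one U ⊆ W as well, so U ≡ W.
point-outside : ∀ (U W : Subset n) → ∣ U ∣ ≤ ∣ W ∣ → U ≢ W → Escape W U
point-outside U W |U|≤|W| U≢W with escape? W U | escape? U W
... | yes w∈W∖U | _         = w∈W∖U
... | no  none  | yes u∈U∖W =
      contradiction (p⊂q⇒∣p∣<∣q∣ (⊆-if-no-escape W U none , u∈U∖W)) (≤⇒≯ |U|≤|W|)
... | no  none  | no  none′ =
      contradiction (⊆-antisym (⊆-if-no-escape U W none′) (⊆-if-no-escape W U none)) U≢W

through : Fin n → List (Subset n) → List (Subset n)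
through x = filter (x ∈?_)

filter-filter : ∀ {a p q} {A : Set a} {P : Pred A p} {Q : Pred A q}
                (P? : Decidable P) (Q? : Decidable Q) (xs : List A) →
                filter P? (filter Q? xs) ≡ filter (λ x → P? x ×-dec Q? x) xs
filter-filter P? Q? [] = refl
filter-filter {P = P} {Q = Q} P? Q? (x ∷ xs) = by-cases (Q? x) (P? x)
  where
  open ≡-Reasoning
  PQ? : Decidable (λ y → P y × Q y)
  PQ? y = P? y ×-dec Q? y

  by-cases : Dec (Q x) → Dec (P x) → filter P? (filter Q? (x ∷ xs)) ≡ filter PQ? (x ∷ xs)
  by-cases (no ¬q) _ = begin
    filter P? (filter Q? (x ∷ xs))  ≡⟨ cong (filter P?) (filter-reject Q? ¬q) ⟩
    filter P? (filter Q? xs)        ≡⟨ filter-filter P? Q? xs ⟩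
    filter PQ? xs                   ≡⟨ filter-reject PQ? (¬q ∘ proj₂) ⟨
    filter PQ? (x ∷ xs)             ∎
  by-cases (yes q) (yes p) = begin
    filter P? (filter Q? (x ∷ xs))  ≡⟨ cong (filter P?) (filter-accept Q? q) ⟩
    filter P? (x ∷ filter Q? xs)    ≡⟨ filter-accept P? p ⟩
    x ∷ filter P? (filter Q? xs)    ≡⟨ cong (x ∷_) (filter-filter P? Q? xs) ⟩
    x ∷ filter PQ? xs               ≡⟨ filter-accept PQ? (p , q) ⟨
    filter PQ? (x ∷ xs)             ∎
  by-cases (yes q) (no ¬p) = begin
    filter P? (filter Q? (x ∷ xs))  ≡⟨ cong (filter P?) (filter-accept Q? q) ⟩
    filter P? (x ∷ filter Q? xs)    ≡⟨ filter-reject P? ¬p ⟩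
    filter P? (filter Q? xs)        ≡⟨ filter-filter P? Q? xs ⟩
    filter PQ? xs                   ≡⟨ filter-reject PQ? (¬p ∘ proj₁) ⟨
    filter PQ? (x ∷ xs)             ∎

-- Induction on Ls: the head
-- L meets U, and the tail still meets the strictly smaller set U ─ L, since
-- a point of U in L and in a tail member would lie in two members.
pigeonhole : ∀ (Ls : List (Subset n)) (U : Subset n) →
             (∀ {u} → u ∈ U → length (through u Ls) ≤ 1) →
             All (λ L → Nonempty (U ∩ L)) Ls → length Ls ≤ ∣ U ∣
pigeonhole []       U at-most-once []                 = z≤n
pigeonhole (L ∷ Ls) U at-most-once (U∩L≢∅ ∷ U∩Ls≢∅) =
  ≤-<-trans (pigeonhole Ls (U ─ L) at-most-once′ tail-meets) (p∩q≢∅⇒∣p─q∣<∣p∣ U L U∩L≢∅)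
  where
  at-most-once′ : ∀ {x} → x ∈ U ─ L → length (through x Ls) ≤ 1
  at-most-once′ {x} x∈U─L =
    subst (λ Ms → length Ms ≤ 1) (filter-reject (x ∈?_) (x∈p─q⇒x∉q U L x∈U─L))
          (at-most-once (p─q⊆p U L x∈U─L))

  not-twice : ∀ {u M} → M ∈ˡ Ls → u ∈ U → u ∈ L → u ∉ M
  not-twice {u} M∈Ls u∈U u∈L u∈M =
    ≤⇒≯ (subst (λ Ms → length Ms ≤ 1) (filter-accept (u ∈?_) u∈L) (at-most-once u∈U))
        (s≤s (filter-some (u ∈?_) (Any.map (λ { refl → u∈M }) M∈Ls)))

  meets-U─L : ∀ {M} → M ∈ˡ Ls → Nonempty (U ∩ M) → Nonempty ((U ─ L) ∩ M)
  meets-U─L {M} M∈Ls (u , u∈U∩M) with x∈p∩q⁻ U M u∈U∩M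
  ... | u∈U , u∈M with u ∈? L
  ...   | yes u∈L = contradiction u∈M (not-twice M∈Ls u∈U u∈L)
  ...   | no  u∉L = u , x∈p∩q⁺ (x∈p∧x∉q⇒x∈p─q u∈U u∉L , u∈M)

  tail-meets : All (λ M → Nonempty ((U ─ L) ∩ M)) Ls
  tail-meets = All.tabulate λ M∈Ls → meets-U─L M∈Ls (All.lookup U∩Ls≢∅ M∈Ls)

module _ {v s t α : ℕ} (Γ : PartialGeometry v s t α) where
  open PartialGeometry Γ

  -- Through a point w outside a set U of at most t points there is a line
  -- avoiding U: the t+1 lines through w cannot all meet U, because each point
  -- of U lies on at most one of them, so by pigeonhole at most |U| ≤ t do.
  line-avoiding : ∀ (U : Subset v) (w : Fin v) → ∣ U ∣ ≤ t → w ∉ U →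
                  ∃ λ L → L ∈ˡ lines × w ∈ L × Empty (U ∩ L)
  line-avoiding U w |U|≤t w∉U
    with find (¬All⇒Any¬ (nonempty? ∘ (U ∩_)) (through w lines) not-all-meet)
    where
    at-most-once : ∀ {u} → u ∈ U → length (through u (through w lines)) ≤ 1
    at-most-once {u} u∈U =
      subst (_≤ 1) (sym (cong length (filter-filter (u ∈?_) (w ∈?_) lines)))
            (points-join u w λ { refl → w∉U u∈U })

    not-all-meet : ¬ All (λ L → Nonempty (U ∩ L)) (through w lines)
    not-all-meet all-meet =
      ≤⇒≯ (≤-trans (pigeonhole (through w lines) U at-most-once all-meet) |U|≤t)
          (≤-reflexive (sym (point-degree w)))
  ... | L , L∈through-w , U∩L≡∅
    with L∈lines , w∈L ← ∈-filter⁻ (w ∈?_) {xs = lines} L∈through-w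
    = L , L∈lines , w∈L , U∩L≡∅

module _ {v k : ℕ} where
  open Kneser v k

  adjacent⇒distance-one : ∀ {U X} → IsVertex X → Adjacent U X → U ≢ X → Dist U X 1
  adjacent⇒distance-one {U} {X} X-vertex U∩X≡∅ U≢X = cons X-vertex U∩X≡∅ nil , shortest
    where
    shortest : ∀ m → Walk U X m → 1 ≤ m
    shortest zero    nil = contradiction refl U≢X
    shortest (suc m) _   = s≤s z≤n

  meeting⇒¬distance-one : ∀ {W X} → Nonempty (W ∩ X) → ¬ Dist W X 1
  meeting⇒¬distance-one W∩X≢∅ (cons _ W∩X≡∅ nil , _) = W∩X≡∅ W∩X≢∅

theorem4p1 : ∀ (v s t α : ℕ) (Γ : PartialGeometry v s t α) → s < t →
             Kneser.IsResolvingSet v (suc s) (PartialGeometry.lines Γ)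
theorem4p1 v s t α Γ s<t = line-size , resolve
  where
  open PartialGeometry Γ
  open Kneser v (suc s)

  resolve : ∀ U W → IsVertex U → IsVertex W → U ≢ W →
            ∃ λ X → X ∈ˡ lines × ¬ (∀ d → Dist U X d ⇔ Dist W X d)
  resolve U W |U|≡k |W|≡k U≢W
    with w , w∈W , w∉U ← point-outside U W (≤-reflexive (trans |U|≡k (sym |W|≡k))) U≢W
    with L , L∈lines , w∈L , U∩L≡∅ ← line-avoiding Γ U w (subst (_≤ t) (sym |U|≡k) s<t) w∉U
    = L , L∈lines , λ same-distances →
        meeting⇒¬distance-one (w , x∈p∩q⁺ (w∈W , w∈L))
          (Equivalence.to (same-distances 1)
            (adjacent⇒distance-one (line-size L L∈lines) U∩L≡∅ λ { refl → w∉U w∈L }))
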